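{- Let $N$ be a positive integer, $\Gamma=\Gamma_0(N,3)$, $d$ a positive divisor of $N$, and $\Delta=\gcd(d,N/d)$. Let $P_d$ be the stabilizer in $\mathrm{SL}_3(\mathbb{Q})$ of the line through ${}^t(1,d,0)$, $U_d$ its unipotent radical, $\Gamma_{P_d}=\Gamma\cap P_d$, $\Gamma_{U_d}=\Gamma\cap U_d$, and $\Gamma_{L_d}=\Gamma_{P_d}/\Gamma_{U_d}$. Then $\Gamma_{U_d}\cong\mathbb{Z}^2$ and $\Gamma_{L_d}\cong\Gamma_1(N/d,\Delta)^*$; in particular there is an exact sequence $1\to\Gamma_{U_d}\to\Gamma_{P_d}\to\Gamma_1(N/d,\Delta)^*\to 1$.
   Context: $\Gamma_0(N,3)$ is the group of matrices in $\mathrm{SL}_3(\mathbb{Z})$ whose $(2,1)$ and $(3,1)$ entries are divisible by $N$. For positive integers $M,\Delta$ with $\Delta\mid M$, $\Gamma_1(M,\Delta)^*=\{g=\begin{bmatrix}a&b\\c&D\end{bmatrix}\in\mathrm{GL}_2(\mathbb{Z}) : c\equiv 0\pmod M,\ a\equiv\det(g)\pmod\Delta\}$. -}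

module Defs where

open import Data.Nat as ℕ using (ℕ)
open import Data.Integer as ℤ using (ℤ; +_; -_)
open import Data.Integer.Divisibility as ℤd using ()
open import Data.Rational as ℚ using (ℚ)
open import Data.Fin using (Fin; zero; suc)
open import Data.Vec using (Vec; lookup; tabulate; _∷_; [])
import Data.Vec as V
open import Data.Product using (Σ; _×_; ∃)
open import Relation.Binary.PropositionalEquality using (_≡_)

-- Square integer matrices, as vectors of rows (so that ≡ is entrywise equality).
Mat : ℕ → Set
Mat n = Vec (Vec ℤ n) n

Vec3ℚ : Set
Vec3ℚ = Vec ℚ 3

-- entry (i , j), indices from 0
_[_,_] : ∀ {n} → Mat n → Fin n → Fin n → ℤ
g [ i , j ] = lookup (lookup g i) j

δ : ∀ {n} → Fin n → Fin n → ℤ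
δ zero zero = + 1
δ zero (suc j) = + 0
δ (suc i) zero = + 0
δ (suc i) (suc j) = δ i j

identity : ∀ {n} → Mat n
identity = tabulate λ i → tabulate λ j → δ i j

sumℤ : ∀ {n} → Vec ℤ n → ℤ
sumℤ = V.foldr _ ℤ._+_ (+ 0)

sumℚ : ∀ {n} → Vec ℚ n → ℚ
sumℚ = V.foldr _ ℚ._+_ ℚ.0ℚ

_⊗_ : ∀ {n} → Mat n → Mat n → Mat n
g ⊗ h = tabulate λ i → tabulate λ j → sumℤ (tabulate λ k → g [ i , k ] ℤ.* h [ k , j ])

det2 : Mat 2 → ℤ
det2 g = g [ zero , zero ] ℤ.* g [ suc zero , suc zero ]
         ℤ.- g [ zero , suc zero ] ℤ.* g [ suc zero , zero ]

det3 : Mat 3 → ℤ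
det3 g =
      a ℤ.* (e ℤ.* i ℤ.- f ℤ.* h)
  ℤ.- b ℤ.* (d ℤ.* i ℤ.- f ℤ.* g')
  ℤ.+ c ℤ.* (d ℤ.* h ℤ.- e ℤ.* g')
  where
  i0 i1 i2 : Fin 3
  i0 = zero
  i1 = suc zero
  i2 = suc (suc zero)
  a = g [ i0 , i0 ]
  b = g [ i0 , i1 ]
  c = g [ i0 , i2 ]
  d = g [ i1 , i0 ]
  e = g [ i1 , i1 ]
  f = g [ i1 , i2 ]
  g' = g [ i2 , i0 ]
  h = g [ i2 , i1 ]
  i = g [ i2 , i2 ]

InΓ₀ : ℕ → Mat 3 → Set
InΓ₀ N g = det3 g ≡ + 1
         × (+ N) ℤd.∣ g [ suc zero , zero ]
         × (+ N) ℤd.∣ g [ suc (suc zero) , zero ]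

InΓ₁* : ℕ → ℕ → Mat 2 → Set
InΓ₁* M Δ g = (det2 g ≡ + 1 Data.Sum.⊎ det2 g ≡ - (+ 1))
            × (+ M) ℤd.∣ g [ suc zero , zero ]
            × (+ Δ) ℤd.∣ (g [ zero , zero ] ℤ.- det2 g)
  where import Data.Sum

toℚ : ℤ → ℚ
toℚ z = z ℚ./ 1

vd : ℕ → Vec3ℚ
vd d = ℚ.1ℚ ∷ toℚ (+ d) ∷ ℚ.0ℚ ∷ []

act : Mat 3 → Vec3ℚ → Vec3ℚ
act g w = tabulate λ i → sumℚ (tabulate λ j → toℚ (g [ i , j ]) ℚ.* lookup w j)

OnLine : Vec3ℚ → Vec3ℚ → Set
OnLine v w = ∃ λ (μ : ℚ) → (i : Fin 3) → lookup w i ≡ μ ℚ.* lookup v i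

InP : ℕ → Mat 3 → Set
InP d g = det3 g ≡ + 1 × OnLine (vd d) (act g (vd d))

-- U_d : unipotent radical of P_d, i.e. the elements of SL₃(ℚ) acting trivially on the
-- line L = ℚ·v and on ℚ³/L:  g v = v and (g - 1) w ∈ L for all w ∈ ℚ³
InU : ℕ → Mat 3 → Set
InU d g = det3 g ≡ + 1
        × act g (vd d) ≡ vd d
        × ((w : Vec3ℚ) → OnLine (vd d) (tabulate λ i → lookup (act g w) i ℚ.- lookup w i))

InΓP : ℕ → ℕ → Mat 3 → Set
InΓP N d g = InΓ₀ N g × InP d g

InΓU : ℕ → ℕ → Mat 3 → Set
InΓU N d g = InΓ₀ N g × InU d g

module Submission where

open import Defs
open import Data.Nat using (ℕ; NonZero; _/_)
open import Data.Nat.Divisibility using (_∣_)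
open import Data.Nat.GCD using (gcd)
open import Data.Integer using (ℤ; _+_)
open import Data.Product using (Σ; _×_; _,_; ∃)
open import Relation.Binary.PropositionalEquality using (_≡_)
open import Function.Bundles using (_⇔_)

open import Relation.Nullary.Decidable.Core using (dec⇒maybe)
open import Data.Fin.Base using (Fin; zero; suc)
open import Data.Fin.Patterns using (0F; 1F; 2F)
open import Data.Vec.Base using (Vec; []; _∷_; lookup; tabulate; map)
open import Data.Vec.Properties
  using (tabulate-cong; tabulate-∘; tabulate∘lookup; lookup-map; ∷-injectiveˡ; ∷-injectiveʳ)
open import Data.Product.Base using (proj₁; proj₂; ∃₂)
open import Data.Product.Properties using (,-injective)
open import Data.Sum.Base using (_⊎_; inj₁; inj₂)
open import Function.Base using (_∘_)
open import Function.Bundles using (mk⇔; module Equivalence)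
open import Relation.Binary.PropositionalEquality
  using (refl; sym; trans; cong; cong₂; subst; subst₂; module ≡-Reasoning)

import Data.Nat.Base as ℕ
import Data.Nat.Properties as ℕ
import Data.Nat.Divisibility as ℕ
import Data.Nat.DivMod as ℕ
import Data.Nat.GCD as ℕ
import Data.Nat.Coprimality as ℕ
open import Data.Integer.Base using (+_; -[1+_]; -_; _-_; _*_; ∣_∣; _/ℕ_)
import Data.Integer.Properties as ℤ
import Data.Integer.Divisibility as ℤᵤ
import Data.Integer.Divisibility.Signed as ℤ
open import Data.Integer.Tactic.RingSolver using (solve-∀)
import Data.Rational.Base as ℚ
import Data.Rational.Properties as ℚ
import Data.Rational.Unnormalised.Base as ℚᵘ
import Data.Rational.Unnormalised.Properties as ℚᵘ
import Tactic.RingSolver as RingSolver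
import Tactic.RingSolver.Core.AlmostCommutativeRing as ACR

-- Conjugation by C = [[1,0,0],[-d,1,0],[0,0,1]], which sends v = ᵗ(1,d,0) to e₁, shows
-- that g ∈ P_d exactly when C g C⁻¹ = [[μ, *],[0, A]] is block upper triangular; then
-- det g = μ · det A, so μ = det A = ±1, and g ↦ A is a homomorphism whose kernel
-- (μ = 1, A = 1) is U_d = {u(t,s)}, where u(t,s) = 1 + v·(-d t, t, s).
-- The congruences defining Γ₀(N,3) become: N ∣ d (μ - g₂₂) and N ∣ d g₃₂, that is
-- M ∣ μ - g₂₂ and M ∣ A₂₁ for M = N/d; as A₁₁ = g₂₂ - d g₁₂ and Δ = gcd(d,M) divides
-- both d and M, this says A ∈ Γ₁(M,Δ)^*.  Conversely every A ∈ Γ₁(M,Δ)^* lifts: one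
-- needs x with M ∣ det A - A₁₁ - d x, which exists by Bézout since Δ ∣ A₁₁ - det A.
-- Finally u(t,s) ∈ Γ₀(N,3) iff N ∣ d² t, iff K ∣ t with K = N / gcd(N, d²), so
-- u(x K, s) ↦ (x, s) identifies Γ_{U_d} with ℤ².

linear-consequence : ∀ {x y l r : ℤ} → l ≡ r → x - y ≡ l - r → x ≡ y
linear-consequence {x} {y} l≡r x-y≡l-r =
  ℤ.i-j≡0⇒i≡j x y (trans x-y≡l-r (ℤ.i≡j⇒i-j≡0 l≡r))

∣i∣≡1⇒i≡±1 : ∀ i → ∣ i ∣ ≡ 1 → i ≡ + 1 ⊎ i ≡ - + 1
∣i∣≡1⇒i≡±1 (+ _)      refl = inj₁ refl
∣i∣≡1⇒i≡±1 -[1+ _ ]   refl = inj₂ refl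

i*j≡1⇒∣i∣*∣j∣≡1 : ∀ i j → i * j ≡ + 1 → ∣ i ∣ ℕ.* ∣ j ∣ ≡ 1
i*j≡1⇒∣i∣*∣j∣≡1 i j ij≡1 = trans (sym (ℤ.abs-* i j)) (cong ∣_∣ ij≡1)

i*j≡1⇒j≡±1 : ∀ i j → i * j ≡ + 1 → j ≡ + 1 ⊎ j ≡ - + 1
i*j≡1⇒j≡±1 i j ij≡1 =
  ∣i∣≡1⇒i≡±1 j (ℕ.m*n≡1⇒n≡1 ∣ i ∣ ∣ j ∣ (i*j≡1⇒∣i∣*∣j∣≡1 i j ij≡1))

i*j≡1⇒i≡j : ∀ i j → i * j ≡ + 1 → i ≡ j
i*j≡1⇒i≡j i j ij≡1
  with ∣i∣≡1⇒i≡±1 i (ℕ.m*n≡1⇒m≡1 ∣ i ∣ ∣ j ∣ (i*j≡1⇒∣i∣*∣j∣≡1 i j ij≡1))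
... | inj₁ refl = trans (sym ij≡1) (ℤ.*-identityˡ j)
... | inj₂ refl = sym (trans (sym (ℤ.neg-involutive j)) (cong -_ (trans (sym (ℤ.-1*i≡-i j)) ij≡1)))

i≡±1⇒i*i≡1 : ∀ {i} → i ≡ + 1 ⊎ i ≡ - + 1 → i * i ≡ + 1
i≡±1⇒i*i≡1 (inj₁ refl) = refl
i≡±1⇒i*i≡1 (inj₂ refl) = refl

[i*n]/ℕn≡i : ∀ i n .{{_ : NonZero n}} → (i * + n) /ℕ n ≡ i
[i*n]/ℕn≡i (+ m)    n = trans (cong (_/ℕ n) (sym (ℤ.pos-* m n))) (cong +_ (ℕ.m*n/n≡m m n))
[i*n]/ℕn≡i -[1+ m ] n@(ℕ.suc _) rewrite ℕ.m*n%n≡0 (ℕ.suc m) n {{_}} =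
  cong (λ k → - + k) (ℕ.m*n/n≡m (ℕ.suc m) n)

∣m*x⇔/gcd∣x : ∀ n m x .{{_ : NonZero (gcd n m)}} → (n ∣ m ℕ.* x) ⇔ (n / gcd n m ∣ x)
∣m*x⇔/gcd∣x n m x = mk⇔ to from
  where
  g = gcd n m
  g*[n/g]≡n : g ℕ.* (n / g) ≡ n
  g*[n/g]≡n = ℕ.m*[n/m]≡n (ℕ.gcd[m,n]∣m n m)
  mx≡g*[[m/g]*x] : m ℕ.* x ≡ g ℕ.* (m / g ℕ.* x)
  mx≡g*[[m/g]*x] =
    trans (cong (ℕ._* x) (sym (ℕ.m*[n/m]≡n (ℕ.gcd[m,n]∣n n m)))) (ℕ.*-assoc g (m / g) x)
  to : n ∣ m ℕ.* x → n / g ∣ x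
  to n∣mx = ℕ.coprime-divisor (ℕ.coprime-/gcd n m)
              (ℕ.*-cancelˡ-∣ g (subst₂ _∣_ (sym g*[n/g]≡n) mx≡g*[[m/g]*x] n∣mx))
  from : n / g ∣ x → n ∣ m ℕ.* x
  from n/g∣x = subst₂ _∣_ g*[n/g]≡n (sym mx≡g*[[m/g]*x])
                 (ℕ.*-monoʳ-∣ g (ℕ.∣-trans n/g∣x (ℕ.n∣m*n (m / g))))

ℤ-bézout : ∀ m n → ∃₂ λ u w → + gcd m n ≡ u * + m + w * + n
ℤ-bézout m n = bézout (ℕ.Bézout.identity (ℕ.gcd-GCD m n))
  where
  lift : ∀ a b c d e → a ℕ.+ b ℕ.* c ≡ d ℕ.* e → + a + + b * + c ≡ + d * + e
  lift a b c d e eq = begin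
    + a + + b * + c     ≡⟨ cong (λ i → + a + i) (ℤ.pos-* b c) ⟨
    + a + + (b ℕ.* c)   ≡⟨ ℤ.pos-+ a (b ℕ.* c) ⟨
    + (a ℕ.+ b ℕ.* c)   ≡⟨ cong +_ eq ⟩
    + (d ℕ.* e)         ≡⟨ ℤ.pos-* d e ⟩
    + d * + e           ∎
    where open ≡-Reasoning
  rearrange : ∀ G U W M N → G + W * N ≡ U * M → G ≡ U * M + - W * N
  rearrange G U W M N eq = linear-consequence eq (difference G U W M N)
    where
    difference : ∀ G U W M N → G - (U * M + - W * N) ≡ G + W * N - U * M
    difference = solve-∀
  bézout : ℕ.Bézout.Identity (gcd m n) m n → ∃₂ λ u w → + gcd m n ≡ u * + m + w * + n
  bézout (ℕ.Bézout.+- x y eq) =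
    + x , - + y , rearrange _ (+ x) (+ y) (+ m) (+ n) (lift (gcd m n) y n x m eq)
  bézout (ℕ.Bézout.-+ x y eq) =
    - + x , + y , trans (rearrange _ (+ y) (+ x) (+ n) (+ m) (lift (gcd m n) x m y n eq))
                        (ℤ.+-comm (+ y * + n) (- + x * + m))

linear-congruence-solution : ∀ m n {z} → (+ gcd m n) ℤ.∣ z → ∃ λ x → (+ n) ℤ.∣ z - x * + m
linear-congruence-solution m n (ℤ.divides k refl) with ℤ-bézout m n
... | u , w , g≡um+wn = k * u , ℤ.divides (k * w) (solution g≡um+wn)
  where
  solution : ∀ {G U W M N : ℤ} → G ≡ U * M + W * N → k * G - k * U * M ≡ k * W * N
  solution {U = U} {W} {M} {N} refl = expansion k U W M N
    where
    expansion : ∀ k U W M N → k * (U * M + W * N) - k * U * M ≡ k * W * N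
    expansion = solve-∀

ℚ-ring : ACR.AlmostCommutativeRing _ _
ℚ-ring = ACR.fromCommutativeRing ℚ.+-*-commutativeRing (λ p → dec⇒maybe (ℚ.0ℚ ℚ.≟ p))

toℚᵘ-toℚ : ∀ i → ℚ.toℚᵘ (toℚ i) ℚᵘ.≃ ℚᵘ.mkℚᵘ i 0
toℚᵘ-toℚ i = ℚ.toℚᵘ-fromℚᵘ (ℚᵘ.mkℚᵘ i 0)

toℚ-homo-+ : ∀ i j → toℚ (i + j) ≡ toℚ i ℚ.+ toℚ j
toℚ-homo-+ i j = ℚ.toℚᵘ-injective (begin
  ℚ.toℚᵘ (toℚ (i + j))               ≈⟨ toℚᵘ-toℚ (i + j) ⟩
  ℚᵘ.mkℚᵘ (i + j) 0                   ≈⟨ ℚᵘ.*≡* (cross i j) ⟩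
  ℚᵘ.mkℚᵘ i 0 ℚᵘ.+ ℚᵘ.mkℚᵘ j 0       ≈⟨ ℚᵘ.+-cong (toℚᵘ-toℚ i) (toℚᵘ-toℚ j) ⟨
  ℚ.toℚᵘ (toℚ i) ℚᵘ.+ ℚ.toℚᵘ (toℚ j) ≈⟨ ℚ.toℚᵘ-homo-+ (toℚ i) (toℚ j) ⟨
  ℚ.toℚᵘ (toℚ i ℚ.+ toℚ j)           ∎)
  where
  open ℚᵘ.≃-Reasoning
  cross : ∀ i j → (i + j) * + 1 ≡ (i * + 1 + j * + 1) * + 1
  cross = solve-∀

toℚ-homo-* : ∀ i j → toℚ (i * j) ≡ toℚ i ℚ.* toℚ j
toℚ-homo-* i j = ℚ.toℚᵘ-injective (begin
  ℚ.toℚᵘ (toℚ (i * j))               ≈⟨ toℚᵘ-toℚ (i * j) ⟩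
  ℚᵘ.mkℚᵘ (i * j) 0                   ≈⟨ ℚᵘ.*≡* refl ⟩
  ℚᵘ.mkℚᵘ i 0 ℚᵘ.* ℚᵘ.mkℚᵘ j 0       ≈⟨ ℚᵘ.*-cong (toℚᵘ-toℚ i) (toℚᵘ-toℚ j) ⟨
  ℚ.toℚᵘ (toℚ i) ℚᵘ.* ℚ.toℚᵘ (toℚ j) ≈⟨ ℚ.toℚᵘ-homo-* (toℚ i) (toℚ j) ⟨
  ℚ.toℚᵘ (toℚ i ℚ.* toℚ j)           ∎)
  where open ℚᵘ.≃-Reasoning

toℚ-homo‿- : ∀ i → toℚ (- i) ≡ ℚ.- toℚ i
toℚ-homo‿- i = ℚ.toℚᵘ-injective (begin
  ℚ.toℚᵘ (toℚ (- i))   ≈⟨ toℚᵘ-toℚ (- i) ⟩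
  ℚᵘ.mkℚᵘ (- i) 0      ≡⟨⟩
  ℚᵘ.- ℚᵘ.mkℚᵘ i 0     ≈⟨ ℚᵘ.-‿cong (toℚᵘ-toℚ i) ⟨
  ℚᵘ.- ℚ.toℚᵘ (toℚ i)  ≈⟨ ℚ.toℚᵘ-homo‿- (toℚ i) ⟨
  ℚ.toℚᵘ (ℚ.- toℚ i)   ∎)
  where open ℚᵘ.≃-Reasoning

toℚ-homo-sub : ∀ i j → toℚ (i - j) ≡ toℚ i ℚ.- toℚ j
toℚ-homo-sub i j = trans (toℚ-homo-+ i (- j)) (cong (toℚ i ℚ.+_) (toℚ-homo‿- j))

toℚ-injective : ∀ {i j} → toℚ i ≡ toℚ j → i ≡ j
toℚ-injective {i} {j} toℚi≡toℚj = begin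
  i         ≡⟨ ℤ.*-identityʳ i ⟨
  i * + 1   ≡⟨ ℚᵘ.drop-*≡* i≃j ⟩
  j * + 1   ≡⟨ ℤ.*-identityʳ j ⟩
  j         ∎
  where
  open ≡-Reasoning
  i≃j : ℚᵘ.mkℚᵘ i 0 ℚᵘ.≃ ℚᵘ.mkℚᵘ j 0
  i≃j = ℚᵘ.≃-trans (ℚᵘ.≃-sym (toℚᵘ-toℚ i))
                   (ℚᵘ.≃-trans (ℚ.toℚᵘ-cong toℚi≡toℚj) (toℚᵘ-toℚ j))

map-toℚ-injective : ∀ {n} {x y : Vec ℤ n} → map toℚ x ≡ map toℚ y → x ≡ y
map-toℚ-injective {x = []}    {[]}    _  = refl
map-toℚ-injective {x = _ ∷ _} {_ ∷ _} eq =
  cong₂ _∷_ (toℚ-injective (∷-injectiveˡ eq)) (map-toℚ-injective (∷-injectiveʳ eq))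

toℚ-sumℤ : ∀ {n} (f : Fin n → ℤ) → toℚ (sumℤ (tabulate f)) ≡ sumℚ (tabulate (toℚ ∘ f))
toℚ-sumℤ {ℕ.zero}  f = refl
toℚ-sumℤ {ℕ.suc n} f =
  trans (toℚ-homo-+ (f zero) _) (cong (toℚ (f zero) ℚ.+_) (toℚ-sumℤ (f ∘ suc)))

-- Subscripts in names count rows and columns from 1, as in the paper; Fin indices count from 0.
pattern mat3 a b c e f h p q r =
  (a ∷ b ∷ c ∷ []) ∷ (e ∷ f ∷ h ∷ []) ∷ (p ∷ q ∷ r ∷ []) ∷ []

pattern mat2 a b c e = (a ∷ b ∷ []) ∷ (c ∷ e ∷ []) ∷ []

mat3-cong : ∀ {a b c e f h p q r a′ b′ c′ e′ f′ h′ p′ q′ r′ : ℤ} →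
  a ≡ a′ → b ≡ b′ → c ≡ c′ → e ≡ e′ → f ≡ f′ → h ≡ h′ → p ≡ p′ → q ≡ q′ → r ≡ r′ →
  _≡_ {A = Mat 3} (mat3 a b c e f h p q r) (mat3 a′ b′ c′ e′ f′ h′ p′ q′ r′)
mat3-cong refl refl refl refl refl refl refl refl refl = refl

Mat-ext : ∀ {n} {A B : Mat n} → (∀ i j → A [ i , j ] ≡ B [ i , j ]) → A ≡ B
Mat-ext {A = A} {B} A≐B = begin
  A                    ≡⟨ tabulate∘lookup A ⟨
  tabulate (lookup A)  ≡⟨ tabulate-cong row ⟩
  tabulate (lookup B)  ≡⟨ tabulate∘lookup B ⟩
  B                    ∎
  where
  open ≡-Reasoning
  row : ∀ i → lookup A i ≡ lookup B i
  row i = trans (sym (tabulate∘lookup (lookup A i)))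
                (trans (tabulate-cong (A≐B i)) (tabulate∘lookup (lookup B i)))

actℤ : ∀ {n} → Mat n → Vec ℤ n → Vec ℤ n
actℤ g w = tabulate λ i → sumℤ (tabulate λ j → g [ i , j ] * lookup w j)

act-toℚ : ∀ g w → act g (map toℚ w) ≡ map toℚ (actℤ g w)
act-toℚ g w = begin
  act g (map toℚ w)
    ≡⟨ tabulate-cong (λ i → cong sumℚ (tabulate-cong (entry i))) ⟩
  tabulate (λ i → sumℚ (tabulate λ j → toℚ (g [ i , j ] * lookup w j)))
    ≡⟨ tabulate-cong (λ i → sym (toℚ-sumℤ λ j → g [ i , j ] * lookup w j)) ⟩
  tabulate (λ i → toℚ (sumℤ (tabulate λ j → g [ i , j ] * lookup w j)))
    ≡⟨ tabulate-∘ toℚ (λ i → sumℤ (tabulate λ j → g [ i , j ] * lookup w j)) ⟩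
  map toℚ (actℤ g w) ∎
  where
  open ≡-Reasoning
  entry : ∀ i j → toℚ (g [ i , j ]) ℚ.* lookup (map toℚ w) j ≡ toℚ (g [ i , j ] * lookup w j)
  entry i j = trans (cong (toℚ (g [ i , j ]) ℚ.*_) (lookup-map j toℚ w))
                    (sym (toℚ-homo-* (g [ i , j ]) (lookup w j)))

displacement : Mat 3 → Vec ℤ 3 → Vec ℤ 3
displacement g w = tabulate λ i → lookup (actℤ g w) i - lookup w i

displacement-toℚ : ∀ g w → tabulate (λ i → lookup (act g (map toℚ w)) i ℚ.- lookup (map toℚ w) i)
                           ≡ map toℚ (displacement g w)
displacement-toℚ g w =
  trans (tabulate-cong entry) (tabulate-∘ toℚ λ i → lookup (actℤ g w) i - lookup w i)
  where
  entry : ∀ i → lookup (act g (map toℚ w)) i ℚ.- lookup (map toℚ w) i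
              ≡ toℚ (lookup (actℤ g w) i - lookup w i)
  entry i = trans
    (cong₂ ℚ._-_ (trans (cong (λ v → lookup v i) (act-toℚ g w)) (lookup-map i toℚ (actℤ g w)))
                 (lookup-map i toℚ w))
    (sym (toℚ-homo-sub (lookup (actℤ g w) i) (lookup w i)))

-- vd d reduces to map toℚ (vdℤ (+ d)).
vdℤ : ℤ → Vec ℤ 3
vdℤ D = + 1 ∷ D ∷ + 0 ∷ []

e₂ e₃ : Vec ℤ 3
e₂ = + 0 ∷ + 1 ∷ + 0 ∷ []
e₃ = + 0 ∷ + 0 ∷ + 1 ∷ []

OnLineℤ : ℤ → Vec ℤ 3 → Set
OnLineℤ D y = lookup y 1F ≡ lookup y 0F * D × lookup y 2F ≡ + 0

onLine-vd⇔ : ∀ d y → OnLine (vd d) (map toℚ y) ⇔ OnLineℤ (+ d) y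
onLine-vd⇔ d y@(y₀ ∷ y₁ ∷ y₂ ∷ []) = mk⇔ to from
  where
  to : OnLine (vd d) (map toℚ y) → OnLineℤ (+ d) y
  to (μ , y≡μv) = toℚ-injective (begin
      toℚ y₁                  ≡⟨ y≡μv 1F ⟩
      μ ℚ.* toℚ (+ d)         ≡⟨ cong (ℚ._* toℚ (+ d)) μ≡y₀ ⟩
      toℚ y₀ ℚ.* toℚ (+ d)    ≡⟨ toℚ-homo-* y₀ (+ d) ⟨
      toℚ (y₀ * + d)          ∎)
    , toℚ-injective (trans (y≡μv 2F) (ℚ.*-zeroʳ μ))
    where
    open ≡-Reasoning
    μ≡y₀ : μ ≡ toℚ y₀
    μ≡y₀ = sym (trans (y≡μv 0F) (ℚ.*-identityʳ μ))
  from : OnLineℤ (+ d) y → OnLine (vd d) (map toℚ y)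
  from (y₁≡y₀d , y₂≡0) = toℚ y₀ , λ where
    0F → sym (ℚ.*-identityʳ (toℚ y₀))
    1F → trans (cong toℚ y₁≡y₀d) (toℚ-homo-* y₀ (+ d))
    2F → trans (cong toℚ y₂≡0) (sym (ℚ.*-zeroʳ (toℚ y₀)))

PreservesLine : ℤ → Mat 3 → Set
PreservesLine D g = OnLineℤ D (actℤ g (vdℤ D))

InP⇔ : ∀ d g → InP d g ⇔ (det3 g ≡ + 1 × PreservesLine (+ d) g)
InP⇔ d g = mk⇔
  (λ (det≡1 , gv∈L) → det≡1 , Equivalence.to (onLine-vd⇔ d (actℤ g v))
                                 (subst (OnLine (vd d)) (act-toℚ g v) gv∈L))
  (λ (det≡1 , gv∈L) → det≡1 , subst (OnLine (vd d)) (sym (act-toℚ g v))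
                                 (Equivalence.from (onLine-vd⇔ d (actℤ g v)) gv∈L))
  where
  v : Vec ℤ 3
  v = vdℤ (+ d)

-- Parabolic and unipotent matrices

-- g ᵗ(1,D,0) = μ ᵗ(1,D,0) with μ = a + b D determines the first column from the others.
parabolicForm : (D a b c f h q r : ℤ) → Mat 3
parabolicForm D a b c f h q r = mat3 a b c ((a + b * D - f) * D) f h (- q * D) q r

data Parabolic (D : ℤ) : Mat 3 → Set where
  parabolic : ∀ a b c f h q r → Parabolic D (parabolicForm D a b c f h q r)

-- 1 + ᵗ(1,D,0) · (-D t, t, s)
unipotentForm : (D t s : ℤ) → Mat 3
unipotentForm D t s = mat3 (+ 1 - D * t) t s (- (D * D * t)) (+ 1 + D * t) (D * s) (+ 0) (+ 0) (+ 1)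

data Unipotent (D : ℤ) : Mat 3 → Set where
  unipotent : ∀ t s → Unipotent D (unipotentForm D t s)

eigenvalue : ℤ → Mat 3 → ℤ
eigenvalue D g = g [ 0F , 0F ] + g [ 0F , 1F ] * D

-- The lower right block of C g C⁻¹ for C = [[1,0,0],[-D,1,0],[0,0,1]].
levi : ℤ → Mat 3 → Mat 2
levi D g = mat2 (g [ 1F , 1F ] - D * g [ 0F , 1F ]) (g [ 1F , 2F ] - D * g [ 0F , 2F ])
                (g [ 2F , 1F ]) (g [ 2F , 2F ])

row·vd : ∀ x y z D → x * + 1 + (y * D + (z * + 0 + + 0)) ≡ x + y * D
row·vd = solve-∀

row·e₂ : ∀ x y z → x * + 0 + (y * + 1 + (z * + 0 + + 0)) ≡ y
row·e₂ = solve-∀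

row·e₃ : ∀ x y z → x * + 0 + (y * + 0 + (z * + 1 + + 0)) ≡ z
row·e₃ = solve-∀

actℤ-vd : ∀ D g → actℤ g (vdℤ D) ≡ tabulate λ i → g [ i , 0F ] + g [ i , 1F ] * D
actℤ-vd D (mat3 a b c e f h p q r) =
  cong₂ _∷_ (row·vd a b c D) (cong₂ _∷_ (row·vd e f h D) (cong₂ _∷_ (row·vd p q r D) refl))

actℤ-e₂ : ∀ g → actℤ g e₂ ≡ tabulate λ i → g [ i , 1F ]
actℤ-e₂ (mat3 a b c e f h p q r) =
  cong₂ _∷_ (row·e₂ a b c) (cong₂ _∷_ (row·e₂ e f h) (cong₂ _∷_ (row·e₂ p q r) refl))

actℤ-e₃ : ∀ g → actℤ g e₃ ≡ tabulate λ i → g [ i , 2F ]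
actℤ-e₃ (mat3 a b c e f h p q r) =
  cong₂ _∷_ (row·e₃ a b c) (cong₂ _∷_ (row·e₃ e f h) (cong₂ _∷_ (row·e₃ p q r) refl))

PreservesLine⇒Parabolic : ∀ D g → PreservesLine D g → Parabolic D g
PreservesLine⇒Parabolic D (mat3 a b c e f h p q r) gv∈L =
  shape (linear-consequence (proj₁ rows) (e-identity a b e f D))
        (linear-consequence (proj₂ rows) (p-identity p q D))
  where
  rows : e + f * D ≡ (a + b * D) * D × p + q * D ≡ + 0
  rows = subst (OnLineℤ D) (actℤ-vd D (mat3 a b c e f h p q r)) gv∈L
  e-identity : ∀ a b e f D → e - (a + b * D - f) * D ≡ e + f * D - (a + b * D) * D
  e-identity = solve-∀
  p-identity : ∀ p q D → p - - q * D ≡ p + q * D - + 0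
  p-identity = solve-∀
  shape : ∀ {e p} → e ≡ (a + b * D - f) * D → p ≡ - q * D → Parabolic D (mat3 a b c e f h p q r)
  shape refl refl = parabolic a b c f h q r

Parabolic⇒PreservesLine : ∀ {D g} → Parabolic D g → PreservesLine D g
Parabolic⇒PreservesLine {D} (parabolic a b c f h q r) =
  subst (OnLineℤ D) (sym (actℤ-vd D (parabolicForm D a b c f h q r)))
        (e-identity a b f D , p-identity q D)
  where
  e-identity : ∀ a b f D → (a + b * D - f) * D + f * D ≡ (a + b * D) * D
  e-identity = solve-∀
  p-identity : ∀ q D → - q * D + q * D ≡ + 0
  p-identity = solve-∀

InP⇒Parabolic : ∀ d g → InP d g → Parabolic (+ d) g
InP⇒Parabolic d g g∈P = PreservesLine⇒Parabolic (+ d) g (proj₂ (Equivalence.to (InP⇔ d g) g∈P))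

Parabolic⇒InP : ∀ d {g} → Parabolic (+ d) g → det3 g ≡ + 1 → InP d g
Parabolic⇒InP d {g} P det≡1 = Equivalence.from (InP⇔ d g) (det≡1 , Parabolic⇒PreservesLine P)

det3-parabolic : ∀ {D g} → Parabolic D g → det3 g ≡ eigenvalue D g * det2 (levi D g)
det3-parabolic {D} (parabolic a b c f h q r) = expansion D a b c f h q r
  where
  expansion : ∀ D a b c f h q r →
      a * (f * r - h * q) - b * ((a + b * D - f) * D * r - h * (- q * D))
    + c * ((a + b * D - f) * D * q - f * (- q * D))
    ≡ (a + b * D) * ((f - D * b) * r - (h - D * c) * q)
  expansion = solve-∀

levi-⊗ : ∀ {D g g′} → Parabolic D g → Parabolic D g′ →
         levi D (g ⊗ g′) ≡ levi D g ⊗ levi D g′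
levi-⊗ {D} (parabolic a b c f h q r) (parabolic a′ b′ c′ f′ h′ q′ r′) = Mat-ext λ where
    0F 0F → entry₁₁ D a b c f h b′ f′ q′
    0F 1F → entry₁₂ D a b c f h c′ h′ r′
    1F 0F → entry₂₁ D q r b′ f′ q′
    1F 1F → entry₂₂ D q r c′ h′ r′
  where
  entry₁₁ : ∀ D a b c f h b′ f′ q′ →
      (a + b * D - f) * D * b′ + (f * f′ + (h * q′ + + 0))
    - D * (a * b′ + (b * f′ + (c * q′ + + 0)))
    ≡ (f - D * b) * (f′ - D * b′) + ((h - D * c) * q′ + + 0)
  entry₁₁ = solve-∀
  entry₁₂ : ∀ D a b c f h c′ h′ r′ →
      (a + b * D - f) * D * c′ + (f * h′ + (h * r′ + + 0))
    - D * (a * c′ + (b * h′ + (c * r′ + + 0)))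
    ≡ (f - D * b) * (h′ - D * c′) + ((h - D * c) * r′ + + 0)
  entry₁₂ = solve-∀
  entry₂₁ : ∀ D q r b′ f′ q′ →
    - q * D * b′ + (q * f′ + (r * q′ + + 0)) ≡ q * (f′ - D * b′) + (r * q′ + + 0)
  entry₂₁ = solve-∀
  entry₂₂ : ∀ D q r c′ h′ r′ →
    - q * D * c′ + (q * h′ + (r * r′ + + 0)) ≡ q * (h′ - D * c′) + (r * r′ + + 0)
  entry₂₂ = solve-∀

parabolicForm-unipotentForm : ∀ D t s →
  parabolicForm D (+ 1 - D * t) t s (+ 1 + D * t) (D * s) (+ 0) (+ 1) ≡ unipotentForm D t s
parabolicForm-unipotentForm D t s = mat3-cong refl refl refl (e-identity D t) refl refl refl refl refl
  where
  e-identity : ∀ D t → (+ 1 - D * t + t * D - (+ 1 + D * t)) * D ≡ - (D * D * t)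
  e-identity = solve-∀

trivialLevi⇒Unipotent : ∀ {D} a b c f h q r → a + b * D ≡ + 1 →
  f - D * b ≡ + 1 → h - D * c ≡ + 0 → q ≡ + 0 → r ≡ + 1 →
  Unipotent D (parabolicForm D a b c f h q r)
trivialLevi⇒Unipotent {D} a b c f h q r μ≡1 α≡1 β≡0 =
  shape (linear-consequence μ≡1 (a-identity a b D)) (linear-consequence α≡1 (f-identity b f D))
        (ℤ.i-j≡0⇒i≡j h (D * c) β≡0)
  where
  a-identity : ∀ a b D → a - (+ 1 - D * b) ≡ a + b * D - + 1
  a-identity = solve-∀
  f-identity : ∀ b f D → f - (+ 1 + D * b) ≡ f - D * b - + 1
  f-identity = solve-∀
  shape : ∀ {a f h q r} → a ≡ + 1 - D * b → f ≡ + 1 + D * b → h ≡ D * c →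
          q ≡ + 0 → r ≡ + 1 → Unipotent D (parabolicForm D a b c f h q r)
  shape refl refl refl refl refl =
    subst (Unipotent D) (sym (parabolicForm-unipotentForm D b c)) (unipotent b c)

levi≡1⇒Unipotent : ∀ {D g} → Parabolic D g → det3 g ≡ + 1 →
                   levi D g ≡ identity → Unipotent D g
levi≡1⇒Unipotent {D} P@(parabolic a b c f h q r) det≡1 levi≡1 =
  trivialLevi⇒Unipotent a b c f h q r μ≡1 (entry 0F 0F) (entry 0F 1F) (entry 1F 0F) (entry 1F 1F)
  where
  entry : ∀ i j → levi D (parabolicForm D a b c f h q r) [ i , j ] ≡ identity [ i , j ]
  entry i j = cong (λ A → A [ i , j ]) levi≡1
  μ≡1 : a + b * D ≡ + 1
  μ≡1 = begin
    a + b * D                                   ≡⟨ ℤ.*-identityʳ _ ⟨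
    (a + b * D) * + 1                           ≡⟨ cong (λ A → (a + b * D) * det2 A) levi≡1 ⟨
    (a + b * D) * det2 (levi D (parabolicForm D a b c f h q r)) ≡⟨ det3-parabolic P ⟨
    det3 (parabolicForm D a b c f h q r)        ≡⟨ det≡1 ⟩
    + 1                                         ∎
    where open ≡-Reasoning

unipotentConditions⇒Unipotent : ∀ {D g} → Parabolic D g → actℤ g (vdℤ D) ≡ vdℤ D →
  OnLineℤ D (displacement g e₂) → OnLineℤ D (displacement g e₃) → Unipotent D g
unipotentConditions⇒Unipotent {D} (parabolic a b c f h q r) gv≡v e₂↦L e₃↦L =
  trivialLevi⇒Unipotent a b c f h q r μ≡1
    (linear-consequence (proj₁ column₂) (α-identity b f D))
    (linear-consequence (proj₁ column₃) (β-identity c h D))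
    (trans (sym (ℤ.+-identityʳ q)) (proj₂ column₂)) (ℤ.i-j≡0⇒i≡j r (+ 1) (proj₂ column₃))
  where
  P = parabolicForm D a b c f h q r
  μ≡1 : a + b * D ≡ + 1
  μ≡1 = ∷-injectiveˡ (trans (sym (actℤ-vd D P)) gv≡v)
  column₂ : f - + 1 ≡ (b - + 0) * D × q - + 0 ≡ + 0
  column₂ = subst (OnLineℤ D) (cong (λ y → tabulate λ i → lookup y i - lookup e₂ i) (actℤ-e₂ P))
                  e₂↦L
  column₃ : h - + 0 ≡ (c - + 0) * D × r - + 1 ≡ + 0
  column₃ = subst (OnLineℤ D) (cong (λ y → tabulate λ i → lookup y i - lookup e₃ i) (actℤ-e₃ P))
                  e₃↦L
  α-identity : ∀ b f D → f - D * b - + 1 ≡ f - + 1 - (b - + 0) * D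
  α-identity = solve-∀
  β-identity : ∀ c h D → h - D * c - + 0 ≡ h - + 0 - (c - + 0) * D
  β-identity = solve-∀

InU⇒Unipotent : ∀ d g → InU d g → Unipotent (+ d) g
InU⇒Unipotent d g (_ , gv≡v , displacement∈L) =
  unipotentConditions⇒Unipotent
    (PreservesLine⇒Parabolic (+ d) g (subst (OnLineℤ (+ d)) (sym gvℤ≡v) v∈L))
    gvℤ≡v (onLine e₂) (onLine e₃)
  where
  gvℤ≡v : actℤ g (vdℤ (+ d)) ≡ vdℤ (+ d)
  gvℤ≡v = map-toℚ-injective (trans (sym (act-toℚ g (vdℤ (+ d)))) gv≡v)
  v∈L : OnLineℤ (+ d) (vdℤ (+ d))
  v∈L = sym (ℤ.*-identityˡ (+ d)) , refl
  onLine : ∀ w → OnLineℤ (+ d) (displacement g w)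
  onLine w = Equivalence.to (onLine-vd⇔ d (displacement g w))
               (subst (OnLine (vd d)) (displacement-toℚ g w) (displacement∈L (map toℚ w)))

det3-unipotentForm : ∀ D t s → det3 (unipotentForm D t s) ≡ + 1
det3-unipotentForm = expansion
  where
  expansion : ∀ D t s →
      (+ 1 - D * t) * ((+ 1 + D * t) * + 1 - D * s * + 0) - t * (- (D * D * t) * + 1 - D * s * + 0)
    + s * (- (D * D * t) * + 0 - (+ 1 + D * t) * + 0)
    ≡ + 1
  expansion = solve-∀

unipotentForm-fixes : ∀ D t s → actℤ (unipotentForm D t s) (vdℤ D) ≡ vdℤ D
unipotentForm-fixes D t s =
  trans (actℤ-vd D (unipotentForm D t s)) (cong₂ _∷_ (row₁ D t) (cong₂ _∷_ (row₂ D t) refl))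
  where
  row₁ : ∀ D t → + 1 - D * t + t * D ≡ + 1
  row₁ = solve-∀
  row₂ : ∀ D t → - (D * D * t) + (+ 1 + D * t) * D ≡ D
  row₂ = solve-∀

unipotentForm-⊗-row₁ : ∀ D t s t′ s′ → let u = unipotentForm D t s ⊗ unipotentForm D t′ s′ in
  u [ 0F , 1F ] ≡ t + t′ × u [ 0F , 2F ] ≡ s + s′
unipotentForm-⊗-row₁ D t s t′ s′ = entry₁₂ D t s t′ , entry₁₃ D t s s′
  where
  entry₁₂ : ∀ D t s t′ →
    (+ 1 - D * t) * t′ + (t * (+ 1 + D * t′) + (s * + 0 + + 0)) ≡ t + t′
  entry₁₂ = solve-∀
  entry₁₃ : ∀ D t s s′ →
    (+ 1 - D * t) * s′ + (t * (D * s′) + (s * + 1 + + 0)) ≡ s + s′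
  entry₁₃ = solve-∀

levi-unipotent : ∀ {D g} → Unipotent D g → levi D g ≡ identity
levi-unipotent {D} (unipotent t s) = Mat-ext λ where
    0F 0F → α-identity D t
    0F 1F → ℤ.+-inverseʳ (D * s)
    1F 0F → refl
    1F 1F → refl
  where
  α-identity : ∀ D t → + 1 + D * t - D * t ≡ + 1
  α-identity = solve-∀

Unipotent⇒InU : ∀ d {g} → Unipotent (+ d) g → InU d g
Unipotent⇒InU d (unipotent t s) = det3-unipotentForm D t s , fixes , displacement∈L
  where
  D = + d
  u = unipotentForm D t s
  Dℚ Tℚ Sℚ : ℚ.ℚ
  Dℚ = toℚ D
  Tℚ = toℚ t
  Sℚ = toℚ s
  fixes : act u (vd d) ≡ vd d
  fixes = trans (act-toℚ u (vdℤ D)) (cong (map toℚ) (unipotentForm-fixes D t s))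
  u₁₁ : toℚ (+ 1 - D * t) ≡ ℚ.1ℚ ℚ.- Dℚ ℚ.* Tℚ
  u₁₁ = trans (toℚ-homo-sub (+ 1) (D * t)) (cong (λ x → ℚ.1ℚ ℚ.- x) (toℚ-homo-* D t))
  u₂₁ : toℚ (- (D * D * t)) ≡ ℚ.- (Dℚ ℚ.* Dℚ ℚ.* Tℚ)
  u₂₁ = trans (toℚ-homo‿- (D * D * t))
              (cong ℚ.-_ (trans (toℚ-homo-* (D * D) t) (cong (ℚ._* Tℚ) (toℚ-homo-* D D))))
  u₂₂ : toℚ (+ 1 + D * t) ≡ ℚ.1ℚ ℚ.+ Dℚ ℚ.* Tℚ
  u₂₂ = trans (toℚ-homo-+ (+ 1) (D * t)) (cong (ℚ.1ℚ ℚ.+_) (toℚ-homo-* D t))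
  -- (u - 1) w = (- D T w₀ + T w₁ + S w₂) · ᵗ(1, D, 0), row by row
  row₁ : ∀ D T S w₀ w₁ w₂ →
      (ℚ.1ℚ ℚ.- D ℚ.* T) ℚ.* w₀ ℚ.+ (T ℚ.* w₁ ℚ.+ (S ℚ.* w₂ ℚ.+ ℚ.0ℚ)) ℚ.- w₀
    ≡ (ℚ.- (D ℚ.* T) ℚ.* w₀ ℚ.+ T ℚ.* w₁ ℚ.+ S ℚ.* w₂) ℚ.* ℚ.1ℚ
  row₁ = RingSolver.solve-∀ ℚ-ring
  row₂ : ∀ D T S w₀ w₁ w₂ →
      ℚ.- (D ℚ.* D ℚ.* T) ℚ.* w₀ ℚ.+ ((ℚ.1ℚ ℚ.+ D ℚ.* T) ℚ.* w₁ ℚ.+ (D ℚ.* S ℚ.* w₂ ℚ.+ ℚ.0ℚ)) ℚ.- w₁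
    ≡ (ℚ.- (D ℚ.* T) ℚ.* w₀ ℚ.+ T ℚ.* w₁ ℚ.+ S ℚ.* w₂) ℚ.* D
  row₂ = RingSolver.solve-∀ ℚ-ring
  row₃ : ∀ D T S w₀ w₁ w₂ →
      ℚ.0ℚ ℚ.* w₀ ℚ.+ (ℚ.0ℚ ℚ.* w₁ ℚ.+ (ℚ.1ℚ ℚ.* w₂ ℚ.+ ℚ.0ℚ)) ℚ.- w₂
    ≡ (ℚ.- (D ℚ.* T) ℚ.* w₀ ℚ.+ T ℚ.* w₁ ℚ.+ S ℚ.* w₂) ℚ.* ℚ.0ℚ
  row₃ = RingSolver.solve-∀ ℚ-ring
  displacement∈L : ∀ w → OnLine (vd d) (tabulate λ i → lookup (act u w) i ℚ.- lookup w i)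
  displacement∈L (w₀ ∷ w₁ ∷ w₂ ∷ []) =
    ℚ.- (Dℚ ℚ.* Tℚ) ℚ.* w₀ ℚ.+ Tℚ ℚ.* w₁ ℚ.+ Sℚ ℚ.* w₂ , λ where
    0F → trans (cong (λ x → x ℚ.* w₀ ℚ.+ (Tℚ ℚ.* w₁ ℚ.+ (Sℚ ℚ.* w₂ ℚ.+ ℚ.0ℚ)) ℚ.- w₀) u₁₁)
               (row₁ Dℚ Tℚ Sℚ w₀ w₁ w₂)
    1F → trans (cong (λ { (x , y , z) → x ℚ.* w₀ ℚ.+ (y ℚ.* w₁ ℚ.+ (z ℚ.* w₂ ℚ.+ ℚ.0ℚ)) ℚ.- w₁ })
                     (cong₂ _,_ u₂₁ (cong₂ _,_ u₂₂ (toℚ-homo-* D s))))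
               (row₂ Dℚ Tℚ Sℚ w₀ w₁ w₂)
    2F → row₃ Dℚ Tℚ Sℚ w₀ w₁ w₂

-- The Levi quotient

Parabolic⇒levi∈Γ₁* : ∀ {M Δ D g} → Parabolic D g → det3 g ≡ + 1 →
  (+ Δ) ℤ.∣ + M → (+ Δ) ℤ.∣ D → (+ M) ℤ.∣ eigenvalue D g - g [ 1F , 1F ] → (+ M) ℤ.∣ g [ 2F , 1F ] →
  InΓ₁* M Δ (levi D g)
Parabolic⇒levi∈Γ₁* {M} {Δ} {D} P@(parabolic a b c f h q r) det≡1 Δ∣M Δ∣D M∣μ-f M∣q =
  i*j≡1⇒j≡±1 μ (det2 A) μ*detA≡1 , ℤ.∣⇒∣ᵤ M∣q , ℤ.∣⇒∣ᵤ Δ∣α-detA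
  where
  μ : ℤ
  μ = a + b * D
  A : Mat 2
  A = levi D (parabolicForm D a b c f h q r)
  μ*detA≡1 : μ * det2 A ≡ + 1
  μ*detA≡1 = trans (sym (det3-parabolic P)) det≡1
  α-μ≡ : (f - D * b) - μ ≡ - (μ - f) - D * b
  α-μ≡ = α-μ-identity a b f D
    where
    α-μ-identity : ∀ a b f D → (f - D * b) - (a + b * D) ≡ - (a + b * D - f) - D * b
    α-μ-identity = solve-∀
  Δ∣α-μ : (+ Δ) ℤ.∣ (f - D * b) - μ
  Δ∣α-μ = subst ((+ Δ) ℤ.∣_) (sym α-μ≡)
            (ℤ.∣m∣n⇒∣m-n (ℤ.∣m⇒∣-m (ℤ.∣-trans Δ∣M M∣μ-f)) (ℤ.∣m⇒∣m*n b Δ∣D))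
  Δ∣α-detA : (+ Δ) ℤ.∣ (f - D * b) - det2 A
  Δ∣α-detA = subst (λ z → (+ Δ) ℤ.∣ (f - D * b) - z) (i*j≡1⇒i≡j μ (det2 A) μ*detA≡1)
                   Δ∣α-μ

liftLevi : ℤ → ℤ → Mat 2 → Mat 3
liftLevi D x k = parabolicForm D (det2 k - x * D) x (+ 0) (k [ 0F , 0F ] + D * x)
                                 (k [ 0F , 1F ]) (k [ 1F , 0F ]) (k [ 1F , 1F ])

liftLevi-parabolic : ∀ D x k → Parabolic D (liftLevi D x k)
liftLevi-parabolic D x k = parabolic (det2 k - x * D) x (+ 0) (k [ 0F , 0F ] + D * x)
                                     (k [ 0F , 1F ]) (k [ 1F , 0F ]) (k [ 1F , 1F ])

levi-liftLevi : ∀ D x k → levi D (liftLevi D x k) ≡ k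
levi-liftLevi D x (mat2 a b c e) = Mat-ext λ where
    0F 0F → α-identity a x D
    0F 1F → β-identity b D
    1F 0F → refl
    1F 1F → refl
  where
  α-identity : ∀ a x D → a + D * x - D * x ≡ a
  α-identity = solve-∀
  β-identity : ∀ b D → b - D * + 0 ≡ b
  β-identity = solve-∀

det3-liftLevi : ∀ D x k → det3 (liftLevi D x k) ≡ det2 k * det2 k
det3-liftLevi D x k =
  trans (det3-parabolic (liftLevi-parabolic D x k))
        (cong₂ _*_ (μ-identity (det2 k) x D) (cong det2 (levi-liftLevi D x k)))
  where
  μ-identity : ∀ ℓ x D → ℓ - x * D + x * D ≡ ℓ
  μ-identity = solve-∀

liftLevi₂₁ : ∀ D x k → liftLevi D x k [ 1F , 0F ] ≡ (- (k [ 0F , 0F ] - det2 k) - x * D) * D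
liftLevi₂₁ D x k = entry-identity (det2 k) (k [ 0F , 0F ]) x D
  where
  entry-identity : ∀ ℓ a x D → (ℓ - x * D + x * D - (a + D * x)) * D ≡ (- (a - ℓ) - x * D) * D
  entry-identity = solve-∀

module LeviQuotient (N d : ℕ) .{{_ : NonZero N}} .{{_ : NonZero d}} (d∣N : d ∣ N) where

  M Δ : ℕ
  M = N / d
  Δ = gcd d M

  D : ℤ
  D = + d

  N∣x*D⇔M∣x : ∀ x → (+ N) ℤᵤ.∣ x * D ⇔ (+ M) ℤ.∣ x
  N∣x*D⇔M∣x x = mk⇔
    (λ N∣xD → ℤ.∣ᵤ⇒∣ (ℤᵤ.*-cancelʳ-∣ D {+ M} {x} (subst (ℤᵤ._∣ x * D) N≡MD N∣xD)))
    (λ M∣x → subst (ℤᵤ._∣ x * D) (sym N≡MD) (ℤᵤ.*-monoˡ-∣ D {+ M} {x} (ℤ.∣⇒∣ᵤ M∣x)))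
    where
    N≡MD : + N ≡ + M * D
    N≡MD = trans (cong +_ (sym (ℕ.m/n*n≡m d∣N))) (ℤ.pos-* M d)

  levi∈Γ₁* : ∀ g → InΓP N d g → InΓ₁* M Δ (levi D g)
  levi∈Γ₁* g ((det≡1 , N∣g₂₁ , N∣g₃₁) , g∈P) =
    go (InP⇒Parabolic d g g∈P) det≡1 N∣g₂₁ N∣g₃₁
    where
    go : ∀ {g} → Parabolic D g → det3 g ≡ + 1 →
         (+ N) ℤᵤ.∣ g [ 1F , 0F ] → (+ N) ℤᵤ.∣ g [ 2F , 0F ] → InΓ₁* M Δ (levi D g)
    go P@(parabolic a b c f h q r) det≡1 N∣g₂₁ N∣g₃₁ =
      Parabolic⇒levi∈Γ₁* P det≡1 (ℤ.∣ᵤ⇒∣ (ℕ.gcd[m,n]∣n d M)) (ℤ.∣ᵤ⇒∣ (ℕ.gcd[m,n]∣m d M))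
        (Equivalence.to (N∣x*D⇔M∣x (a + b * D - f)) N∣g₂₁)
        (subst ((+ M) ℤ.∣_) (ℤ.neg-involutive q)
               (ℤ.∣m⇒∣-m (Equivalence.to (N∣x*D⇔M∣x (- q)) N∣g₃₁)))

  levi-hom : ∀ g h → InΓP N d g → InΓP N d h → levi D (g ⊗ h) ≡ levi D g ⊗ levi D h
  levi-hom g h (_ , g∈P) (_ , h∈P) = levi-⊗ (InP⇒Parabolic d g g∈P) (InP⇒Parabolic d h h∈P)

  levi-surjective : ∀ k → InΓ₁* M Δ k → ∃ λ g → InΓP N d g × levi D g ≡ k
  levi-surjective k (det≡±1 , M∣k₂₁ , Δ∣k₁₁-det)
    with linear-congruence-solution d M (ℤ.∣m⇒∣-m (ℤ.∣ᵤ⇒∣ {+ Δ} {k [ 0F , 0F ] - det2 k} Δ∣k₁₁-det))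
  ... | x , M∣z-xd =
    g , ((det≡1 , N∣g₂₁ , N∣g₃₁) , Parabolic⇒InP d (liftLevi-parabolic D x k) det≡1) , levi-liftLevi D x k
    where
    g : Mat 3
    g = liftLevi D x k
    det≡1 : det3 g ≡ + 1
    det≡1 = trans (det3-liftLevi D x k) (i≡±1⇒i*i≡1 det≡±1)
    N∣g₂₁ : (+ N) ℤᵤ.∣ g [ 1F , 0F ]
    N∣g₂₁ = subst ((+ N) ℤᵤ.∣_) (sym (liftLevi₂₁ D x k))
              (Equivalence.from (N∣x*D⇔M∣x (- (k [ 0F , 0F ] - det2 k) - x * D)) M∣z-xd)
    N∣g₃₁ : (+ N) ℤᵤ.∣ g [ 2F , 0F ]
    N∣g₃₁ = Equivalence.from (N∣x*D⇔M∣x (- k [ 1F , 0F ]))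
              (ℤ.∣m⇒∣-m (ℤ.∣ᵤ⇒∣ {+ M} {k [ 1F , 0F ]} M∣k₂₁))

  levi-kernel : ∀ g → InΓP N d g → (levi D g ≡ identity ⇔ InΓU N d g)
  levi-kernel g (g∈Γ₀ , g∈P) = mk⇔
    (λ levi≡1 → g∈Γ₀ ,
       Unipotent⇒InU d (levi≡1⇒Unipotent (InP⇒Parabolic d g g∈P) (proj₁ g∈Γ₀) levi≡1))
    (λ (_ , g∈U) → levi-unipotent (InU⇒Unipotent d g g∈U))

-- The unipotent radical

module UnipotentRadical (N d : ℕ) .{{_ : NonZero N}} where

  D : ℤ
  D = + d

  instance
    gcd≢0 : NonZero (gcd N (d ℕ.* d))
    gcd≢0 = ℕ.≢-nonZero (ℕ.gcd[m,n]≢0 N (d ℕ.* d) (inj₁ (ℕ.≢-nonZero⁻¹ N)))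

  K : ℕ
  K = N / gcd N (d ℕ.* d)

  instance
    K≢0 : NonZero K
    K≢0 = ℕ.≢-nonZero (ℕ.m/gcd[m,n]≢0 N (d ℕ.* d))

  N∣d²t⇔K∣t : ∀ t → (+ N) ℤᵤ.∣ - (D * D * t) ⇔ (+ K) ℤ.∣ t
  N∣d²t⇔K∣t t = mk⇔
    (λ N∣d²t → ℤ.∣ᵤ⇒∣ {+ K} {t} (Equivalence.to N∣d²x⇔K∣x (subst (N ∣_) ∣d²t∣≡ N∣d²t)))
    (λ K∣t → subst (N ∣_) (sym ∣d²t∣≡) (Equivalence.from N∣d²x⇔K∣x (ℤ.∣⇒∣ᵤ K∣t)))
    where
    N∣d²x⇔K∣x = ∣m*x⇔/gcd∣x N (d ℕ.* d) ∣ t ∣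
    ∣d²t∣≡ : ∣ - (D * D * t) ∣ ≡ d ℕ.* d ℕ.* ∣ t ∣
    ∣d²t∣≡ = trans (ℤ.∣-i∣≡∣i∣ (D * D * t))
                   (trans (ℤ.abs-* (D * D) t) (cong (ℕ._* ∣ t ∣) (ℤ.abs-* D D)))

  data UnipotentΓ : Mat 3 → Set where
    unipotentΓ : ∀ x s → UnipotentΓ (unipotentForm D (x * + K) s)

  InΓU⇒UnipotentΓ : ∀ g → InΓU N d g → UnipotentΓ g
  InΓU⇒UnipotentΓ g ((_ , N∣g₂₁ , _) , g∈U) = go (InU⇒Unipotent d g g∈U) N∣g₂₁
    where
    go : ∀ {g} → Unipotent D g → (+ N) ℤᵤ.∣ g [ 1F , 0F ] → UnipotentΓ g
    go (unipotent t s) N∣d²t with Equivalence.to (N∣d²t⇔K∣t t) N∣d²t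
    ... | ℤ.divides x refl = unipotentΓ x s

  unipotentΓ-InΓU : ∀ x s → InΓU N d (unipotentForm D (x * + K) s)
  unipotentΓ-InΓU x s =
      ( det3-unipotentForm D (x * + K) s
      , Equivalence.from (N∣d²t⇔K∣t (x * + K)) (ℤ.divides x refl)
      , N ℕ.∣0 )
    , Unipotent⇒InU d (unipotent (x * + K) s)

  ψ : Mat 3 → ℤ × ℤ
  ψ g = g [ 0F , 1F ] /ℕ K , g [ 0F , 2F ]

  ψ-unipotentΓ : ∀ x s → ψ (unipotentForm D (x * + K) s) ≡ (x , s)
  ψ-unipotentΓ x s = cong (_, s) ([i*n]/ℕn≡i x K)

  ψ-hom : ∀ g h → InΓU N d g → InΓU N d h →
          ψ (g ⊗ h) ≡ (proj₁ (ψ g) + proj₁ (ψ h) , proj₂ (ψ g) + proj₂ (ψ h))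
  ψ-hom g h g∈ h∈ = hom (InΓU⇒UnipotentΓ g g∈) (InΓU⇒UnipotentΓ h h∈)
    where
    hom : ∀ {g h} → UnipotentΓ g → UnipotentΓ h →
          ψ (g ⊗ h) ≡ (proj₁ (ψ g) + proj₁ (ψ h) , proj₂ (ψ g) + proj₂ (ψ h))
    hom (unipotentΓ x s) (unipotentΓ x′ s′) = begin
      ψ (u ⊗ u′)
        ≡⟨ cong₂ (λ t₁ t₂ → t₁ /ℕ K , t₂) (proj₁ row₁) (proj₂ row₁) ⟩
      ((x * + K + x′ * + K) /ℕ K , s + s′)
        ≡⟨ cong (λ t → t /ℕ K , s + s′) (ℤ.*-distribʳ-+ (+ K) x x′) ⟨
      ((x + x′) * + K /ℕ K , s + s′)
        ≡⟨ ψ-unipotentΓ (x + x′) (s + s′) ⟩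
      (x + x′ , s + s′)
        ≡⟨ cong₂ (λ p p′ → (proj₁ p + proj₁ p′ , proj₂ p + proj₂ p′))
                 (ψ-unipotentΓ x s) (ψ-unipotentΓ x′ s′) ⟨
      (proj₁ (ψ u) + proj₁ (ψ u′) , proj₂ (ψ u) + proj₂ (ψ u′)) ∎
      where
      open ≡-Reasoning
      u = unipotentForm D (x * + K) s
      u′ = unipotentForm D (x′ * + K) s′
      row₁ = unipotentForm-⊗-row₁ D (x * + K) s (x′ * + K) s′

  ψ-injective : ∀ g h → InΓU N d g → InΓU N d h → ψ g ≡ ψ h → g ≡ h
  ψ-injective g h g∈ h∈ = injective (InΓU⇒UnipotentΓ g g∈) (InΓU⇒UnipotentΓ h h∈)
    where
    injective : ∀ {g h} → UnipotentΓ g → UnipotentΓ h → ψ g ≡ ψ h → g ≡ h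
    injective (unipotentΓ x s) (unipotentΓ x′ s′) ψg≡ψh
      with ,-injective (trans (sym (ψ-unipotentΓ x s)) (trans ψg≡ψh (ψ-unipotentΓ x′ s′)))
    ... | refl , refl = refl

  ψ-surjective : ∀ xs → ∃ λ g → InΓU N d g × ψ g ≡ xs
  ψ-surjective (x , s) = unipotentForm D (x * + K) s , unipotentΓ-InΓU x s , ψ-unipotentΓ x s

lemma6p5 : (N d : ℕ) .{{_ : NonZero N}} .{{_ : NonZero d}} → d ∣ N →
    -- Γ_{U_d} ≅ ℤ² : a group isomorphism ψ from (Γ_{U_d}, ⊗) onto (ℤ × ℤ, +)
    (Σ (Mat 3 → ℤ × ℤ) λ ψ →
        ((g h : Mat 3) → InΓU N d g → InΓU N d h →
           ψ (g ⊗ h) ≡ (Σ.proj₁ (ψ g) + Σ.proj₁ (ψ h) , Σ.proj₂ (ψ g) + Σ.proj₂ (ψ h)))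
      × ((g h : Mat 3) → InΓU N d g → InΓU N d h → ψ g ≡ ψ h → g ≡ h)
      × ((x : ℤ × ℤ) → ∃ λ g → InΓU N d g × ψ g ≡ x))
    ×
    -- exact sequence 1 → Γ_{U_d} → Γ_{P_d} →φ Γ₁(N/d, Δ)^* → 1, Δ = gcd(d, N/d)
    (Σ (Mat 3 → Mat 2) λ φ →
        ((g : Mat 3) → InΓP N d g → InΓ₁* (N / d) (gcd d (N / d)) (φ g))
      × ((g h : Mat 3) → InΓP N d g → InΓP N d h → φ (g ⊗ h) ≡ φ g ⊗ φ h)
      × ((k : Mat 2) → InΓ₁* (N / d) (gcd d (N / d)) k → ∃ λ g → InΓP N d g × φ g ≡ k)
      × ((g : Mat 3) → InΓP N d g → (φ g ≡ identity ⇔ InΓU N d g)))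
lemma6p5 N d d∣N =
    (ψ , ψ-hom , ψ-injective , ψ-surjective)
  , (levi (+ d) , levi∈Γ₁* , levi-hom , levi-surjective , levi-kernel)
  where
  open UnipotentRadical N d using (ψ; ψ-hom; ψ-injective; ψ-surjective)
  open LeviQuotient N d d∣N using (levi∈Γ₁*; levi-hom; levi-surjective; levi-kernel)
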